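{- Let $q$ be a prime power, let $n,m,k$ be integers with $1<k<n$ and $m<n\le km$, and let $\lambda\in\mathbb{F}_{q^m}$ with $\mathbb{F}_q(\lambda)=\mathbb{F}_{q^m}$. Let $t=\lfloor (km-n)/m\rfloor$, $a=n-(k-t-2)m$ and $h=\max\{\lfloor a/2^{t+1}\rfloor,1\}$. Define a tuple $\mathbf n$ as follows. If $a\ge t+2$: let $H=\{i\in\mathbb{Z}_{\ge0}:(a-i)/2^{t+1-i}\ge1\}$ and $z=\min H$. If $z=0$, let $(m_1,\dots,m_{t+2})=\Psi(a,t+2)$ and $\mathbf n=(m,\dots,m,m_1,\dots,m_{t+2})$ with $k-t-2$ leading entries equal to $m$. If $z>0$, let $(m_1,\dots,m_{t-z+2})=\Psi(a-z,t-z+2)$ and $\mathbf n=(m,\dots,m,m_1,\dots,m_{t-z+2},1,\dots,1)$ with $k-t-2$ leading entries equal to $m$ and $z$ trailing ones. If $a<t+2$: let $\beta=\lfloor (n-k)/(m-1)\rfloor$, $\gamma=(n-k)-(m-1)\beta$, and $\mathbf n=(m,\dots,m,\gamma+1,1,\dots,1)$ with $\beta$ entries equal to $m$ followed by $\gamma+1$ and then $k-\beta-1$ ones. Then $\mathcal C_{\lambda,\mathbf n}$ is an $[n,k]_{q^m/q}$ code with $\mathrm{WS}(\mathcal C_{\lambda,\mathbf n})=\{h,h+1,\dots,m\}$; in particular it has exactly $m-h+1$ distinct nonzero weights.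
   Context: $\mathbb{F}_{q^m}$ is the degree-$m$ extension of $\mathbb{F}_q$. Rank weight of $\mathbf v=(v_1,\dots,v_n)\in\mathbb{F}_{q^m}^n$: $\mathrm{w}(\mathbf v)=\dim_{\mathbb{F}_q}\langle v_1,\dots,v_n\rangle_{\mathbb{F}_q}$. An $[n,k]_{q^m/q}$ code is a $k$-dimensional $\mathbb{F}_{q^m}$-subspace $\mathcal C\subseteq\mathbb{F}_{q^m}^n$, with weight spectrum $\mathrm{WS}(\mathcal C)=\{\mathrm{w}(\mathbf c):\mathbf c\in\mathcal C\setminus\{\mathbf 0\}\}$. For integers $u\ge v\ge 2$, $\Psi(u,v):=(u_1,\dots,u_v)$ with $u_1=\lceil u/2\rceil$, $u_i=\lceil\lfloor u/2^{i-1}\rfloor/2\rceil$ for $2\le i\le v-1$, $u_v=\lfloor u/2^{v-1}\rfloor$. $\mathbf u_{\lambda,\ell}=(1,\lambda,\dots,\lambda^{\ell-1})\in\mathbb{F}_{q^m}^\ell$ for $\ell\le m$. For a tuple $\mathbf n=(n_1,\dots,n_k)$ of integers in $\{1,\dots,m\}$, $\mathcal C_{\lambda,\mathbf n}$ is the code in $\mathbb{F}_{q^m}^{n_1+\dots+n_k}$ generated by the block-diagonal matrix whose $i$-th row is $\mathbf u_{\lambda,n_i}$ on the $i$-th block of $n_i$ consecutive coordinates (blocks of lengths $n_1,\dots,n_k$ in order) and $0$ elsewhere. -}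

module Defs where

open import Level using (Level; _⊔_)
open import Data.Nat as ℕ using (ℕ; zero; suc; _∸_; _^_; _≤_; _<_; _≤ᵇ_; ⌈_/2⌉)
open import Data.Nat.DivMod using (_/_)
open import Data.Nat.Primality using (Prime)
open import Data.Fin using (Fin)
open import Data.Bool using (if_then_else_)
open import Data.List using (List; []; _∷_; _++_; map; upTo; replicate; concat; zipWith; foldr; length)
open import Data.Nat.ListAction using (sum)
open import Data.List.Relation.Unary.All using (All)
open import Data.Product using (Σ; ∃; _×_; _,_)
open import Data.Sum using (_⊎_)
open import Relation.Nullary using (¬_)
open import Relation.Binary.PropositionalEquality using (_≡_)
open import Algebra.Bundles using (CommutativeRing)

-- floor division, with the (never used under the hypotheses) convention x div 0 = 0
_div_ : ℕ → ℕ → ℕ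
x div zero    = 0
x div (suc y) = x / suc y

IsPrimePower : ℕ → Set
IsPrimePower q = Σ ℕ λ p → Σ ℕ λ e → Prime p × 1 ≤ e × q ≡ p ^ e

module _ {c ℓ : Level} (L : CommutativeRing c ℓ) where
  open CommutativeRing L

  IsFieldCR : Set (c ⊔ ℓ)
  IsFieldCR = (¬ (1# ≈ 0#)) × (∀ x → ¬ (x ≈ 0#) → Σ Carrier λ y → x * y ≈ 1#)

  record IsSubfield {p : Level} (P : Carrier → Set p) : Set (c ⊔ ℓ ⊔ p) where
    field
      resp  : ∀ {x y} → x ≈ y → P x → P y
      has0  : P 0#
      has1  : P 1#
      plus  : ∀ {x y} → P x → P y → P (x + y)
      neg   : ∀ {x} → P x → P (- x)
      times : ∀ {x y} → P x → P y → P (x * y)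
      inv   : ∀ {x} → P x → ¬ (x ≈ 0#) → Σ Carrier λ y → P y × x * y ≈ 1#

  HasCard : {p : Level} → (Carrier → Set p) → ℕ → Set (c ⊔ ℓ ⊔ p)
  HasCard P n = Σ (Fin n → Carrier) λ e →
      (∀ i → P (e i))
    × (∀ i j → e i ≈ e j → i ≡ j)
    × (∀ x → P x → Σ (Fin n) λ i → x ≈ e i)

  -- K(λ) = L : every subfield containing K and λ is all of L
  Generates : (Carrier → Set ℓ) → Carrier → Set (c ⊔ Level.suc ℓ)
  Generates K λ₀ = (S : Carrier → Set ℓ) → IsSubfield S → (∀ x → K x → S x) → S λ₀ → ∀ y → S y

  lincomb : List Carrier → List Carrier → Carrier
  lincomb cs vs = foldr _+_ 0# (zipWith _*_ cs vs)

  InSpan : (Carrier → Set ℓ) → List Carrier → Carrier → Set (c ⊔ ℓ)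
  InSpan K vs y = Σ (List Carrier) λ cs → length cs ≡ length vs × All K cs × lincomb cs vs ≈ y

  Independent : (Carrier → Set ℓ) → List Carrier → Set (c ⊔ ℓ)
  Independent K bs = ∀ cs → length cs ≡ length bs → All K cs → lincomb cs bs ≈ 0# → All (_≈ 0#) cs

  -- rank weight: dim_K ⟨v₁,…,vₙ⟩_K = r  (there is a K-basis of the span of size r)
  RankWeight : (Carrier → Set ℓ) → List Carrier → ℕ → Set (c ⊔ ℓ)
  RankWeight K v r = Σ (List Carrier) λ bs →
      length bs ≡ r × Independent K bs × All (InSpan K v) bs × All (InSpan K bs) v

  pow : Carrier → ℕ → Carrier
  pow x zero    = 1#
  pow x (suc j) = x * pow x j

  uvec : Carrier → ℕ → List Carrier
  uvec λ₀ l = map (pow λ₀) (upTo l)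

  -- the codeword x·G for the block-diagonal generator matrix G of C_{λ,n}
  -- (message xs of length k = length ns)
  codeword : Carrier → List ℕ → List Carrier → List Carrier
  codeword λ₀ ns xs = concat (zipWith (λ x ni → map (x *_) (uvec λ₀ ni)) xs ns)

  IsZeroVec : List Carrier → Set (c ⊔ ℓ)
  IsZeroVec v = All (_≈ 0#) v

  InWS : (Carrier → Set ℓ) → Carrier → List ℕ → ℕ → Set (c ⊔ ℓ)
  InWS K λ₀ ns r = Σ (List Carrier) λ xs →
      length xs ≡ length ns × ¬ IsZeroVec (codeword λ₀ ns xs) × RankWeight K (codeword λ₀ ns xs) r

  -- C_{λ,n} is an [n,k]_{q^m/q} code: k blocks, total length n, entries in {1..m},
  -- and the k rows of the generator matrix are L-linearly independent
  IsCodeParams : Carrier → List ℕ → ℕ → ℕ → ℕ → Set (c ⊔ ℓ)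
  IsCodeParams λ₀ ns n k m =
      length ns ≡ k × sum ns ≡ n × All (λ ni → 1 ≤ ni × ni ≤ m) ns
    × (∀ xs → length xs ≡ length ns → IsZeroVec (codeword λ₀ ns xs) → IsZeroVec xs)

open import Data.Nat using (_+_; _*_)

Ψ : ℕ → ℕ → List ℕ
Ψ u v = map (λ i → ⌈ (u div (2 ^ i)) /2⌉) (upTo (v ∸ 1)) ++ (u div (2 ^ (v ∸ 1)) ∷ [])

tPar : ℕ → ℕ → ℕ → ℕ
tPar n m k = (k * m ∸ n) div m

aPar : ℕ → ℕ → ℕ → ℕ
aPar n m k = n ∸ (k ∸ tPar n m k ∸ 2) * m

hPar : ℕ → ℕ → ℕ → ℕ
hPar n m k = (aPar n m k div (2 ^ (tPar n m k + 1))) ℕ.⊔ 1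

-- i ∈ H = { i ≥ 0 : (a - i)/2^{t+1-i} ≥ 1 }  (rational inequality, split by the sign of t+1-i)
InH : ℕ → ℕ → ℕ → Set
InH a t i = (i ≤ t + 1 × 2 ^ (t + 1 ∸ i) + i ≤ a) ⊎ (t + 1 < i × i < a)

IsMinH : ℕ → ℕ → ℕ → Set
IsMinH a t z = InH a t z × (∀ i → i < z → ¬ InH a t i)

-- the tuple n; z is the minimum of H (only used when a ≥ t+2)
tuple : ℕ → ℕ → ℕ → ℕ → List ℕ
tuple n m k z =
  if (t + 2) ≤ᵇ a
  then (if z ℕ.≡ᵇ 0
        then replicate (k ∸ t ∸ 2) m ++ Ψ a (t + 2)
        else replicate (k ∸ t ∸ 2) m ++ Ψ (a ∸ z) (t ∸ z + 2) ++ replicate z 1)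
  else replicate β m ++ (γ + 1 ∷ []) ++ replicate (k ∸ β ∸ 1) 1
  where
    t = tPar n m k
    a = aPar n m k
    β = (n ∸ k) div (m ∸ 1)
    γ = (n ∸ k) ∸ (m ∸ 1) * β

-- The powers 1, λ, …, λ^(m-1) are K-linearly independent: were λ^D a K-combination of lower powers
-- for some D < m, the K-span of 1, …, λ^(D-1) would be closed under multiplication by λ, hence a
-- subfield containing K and λ, hence all of L, which has q^m > q^D elements. So a nonzero block
-- x·u_{λ,nᵢ} has rank weight nᵢ ≤ m, and every nonzero codeword has weight between the least entry h
-- of 𝐧 and m. Conversely, 𝐧 ends in h and each entry exceeds the sum of the later ones by at most one;
-- taking message coefficients among 0 and the powers of λ, suitable suffixes of 𝐧 then yield codewords
-- whose nonzero entries are exactly 1, λ, …, λ^(r-1), for every r from h to m. That the tuple of the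
-- theorem has these properties is arithmetic on t, a, z and Ψ.
module Submission where

open import Defs
open import Level using (Level; _⊔_)
open import Algebra.Bundles using (CommutativeRing)
import Algebra.Properties.Ring as RingProperties
import Algebra.Solver.Ring.NaturalCoefficients.Default as SemiringSolver
open import Data.Bool using (if_then_else_)
open import Data.Empty using (⊥-elim)
open import Data.Fin as Fin using (Fin; funToFin; finToFun; toℕ)
open import Data.Fin.Properties as Finₚ using (funToFin-finToFin; finToFun-funToFin; injective⇒≤; pigeonhole)
open import Data.List
  using (List; []; _∷_; _++_; _∷ʳ_; map; zipWith; length; replicate; upTo; applyUpTo; tabulate; initLast; _∷ʳ′_)
open import Data.List.Properties
  using (length-map; length-replicate; length-zipWith; length-++; ++-identityʳ; map-++; map-∘; map-cong;
         upTo-∷ʳ; map-upTo; length-upTo; length-tabulate; tabulate-cong)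
open import Data.List.Relation.Unary.All as All using (All; []; _∷_)
open import Data.List.Relation.Unary.All.Properties
  using (map⁺; replicate⁺; tabulate⁺; ∷ʳ⁺; ∷ʳ⁻; ++⁺; ++⁻ˡ; ++⁻ʳ)
open import Data.List.Relation.Unary.Any using (here; there)
open import Data.List.Relation.Binary.Pointwise as Pointwise using (Pointwise; []; _∷_)
import Data.List.Membership.Setoid as SetoidMembership
import Data.List.Membership.Setoid.Properties as SetoidMembershipₚ
open import Data.List.Membership.Propositional.Properties using (∈-upTo⁺; ∈-upTo⁻)
open import Data.Nat as ℕ
  using (ℕ; zero; suc; _^_; _≤_; _<_; z≤n; s≤s; s≤s⁻¹; NonZero; ⌈_/2⌉; ⌊_/2⌋)
import Data.Nat.Properties as ℕₚ
open import Data.Nat.DivMod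
  using (_/_; _%_; n/1≡n; m/n/o≡m/[n*o]; m/n≤m; m/n≡1+[m∸n]/n; m<n⇒m/n≡0; m≥n⇒m/n>0; m<n*o⇒m/o<n;
         m≡m%n+[m/n]*n; m%n<n; m%n≡m∸m/n*n)
open import Data.Nat.ListAction using (sum)
open import Data.Nat.ListAction.Properties using (sum-++)
open import Data.Nat.Tactic.RingSolver using (solve-∀)
open import Data.Product using (Σ; _×_; _,_; proj₁; proj₂)
open import Data.Sum as Sum using (_⊎_; inj₁; inj₂; [_,_]′)
open import Data.Unit using (⊤; tt)
open import Function using (_∘_)
open import Relation.Binary using (Decidable)
import Relation.Binary.Reasoning.Setoid as SetoidReasoning
open import Relation.Binary.PropositionalEquality as ≡ using (_≡_; cong; cong₂)
open import Relation.Nullary using (¬_; Dec; yes; no; contradiction)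
open import Relation.Nullary.Reflects using (Reflects; ofʸ; ofⁿ)

^-cancelʳ-≤ : ∀ {q a b} → 1 < q → q ^ a ≤ q ^ b → a ≤ b
^-cancelʳ-≤ {q} {a} {b} 1<q qᵃ≤qᵇ with ℕₚ.≤-<-connex a b
... | inj₁ a≤b = a≤b
... | inj₂ b<a = contradiction qᵃ≤qᵇ (ℕₚ.<⇒≱ (ℕₚ.^-monoʳ-< q 1<q b<a))

length-∷ʳ-injective : ∀ {a} {A : Set a} (xs ys : List A) {x y} →
  length (xs ∷ʳ x) ≡ length (ys ∷ʳ y) → length xs ≡ length ys
length-∷ʳ-injective xs ys eq =
  ℕₚ.+-cancelʳ-≡ 1 _ _ (≡.trans (≡.sym (length-++ xs)) (≡.trans eq (length-++ ys)))

funToFin-cong : ∀ {d q} {f g : Fin d → Fin q} → (∀ i → f i ≡ g i) → funToFin f ≡ funToFin g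
funToFin-cong {zero}  f≗g = ≡.refl
funToFin-cong {suc d} f≗g = cong₂ Fin.combine (f≗g Fin.zero) (funToFin-cong (f≗g ∘ Fin.suc))

module LinearCombination {c ℓ : Level} (L : CommutativeRing c ℓ) where
  open CommutativeRing L hiding (zero)
  open SetoidReasoning setoid
  open SemiringSolver commutativeSemiring using (solve; _:=_; _:+_; _:*_)

  lincomb-cong : ∀ {cs ds} vs → Pointwise _≈_ cs ds → lincomb L cs vs ≈ lincomb L ds vs
  lincomb-cong []       []         = refl
  lincomb-cong []       (_ ∷ _)    = refl
  lincomb-cong (_ ∷ _)  []         = refl
  lincomb-cong (v ∷ vs) (c≈d ∷ cs≈ds) = +-cong (*-congʳ c≈d) (lincomb-cong vs cs≈ds)

  lincomb-zipWith-+ : ∀ cs ds vs → length cs ≡ length ds →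
    lincomb L (zipWith _+_ cs ds) vs ≈ lincomb L cs vs + lincomb L ds vs
  lincomb-zipWith-+ []       []       _        _  = sym (+-identityʳ 0#)
  lincomb-zipWith-+ (_ ∷ _)  (_ ∷ _)  []       _  = sym (+-identityʳ 0#)
  lincomb-zipWith-+ (c ∷ cs) (d ∷ ds) (v ∷ vs) eq = begin
    (c + d) * v + lincomb L (zipWith _+_ cs ds) vs
      ≈⟨ +-congˡ (lincomb-zipWith-+ cs ds vs (ℕₚ.suc-injective eq)) ⟩
    (c + d) * v + (lincomb L cs vs + lincomb L ds vs)
      ≈⟨ interchange c d v _ _ ⟩
    (c * v + lincomb L cs vs) + (d * v + lincomb L ds vs) ∎
    where
    interchange : ∀ c d v x y → (c + d) * v + (x + y) ≈ (c * v + x) + (d * v + y)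
    interchange = solve 5 (λ c d v x y → (c :+ d) :* v :+ (x :+ y) := (c :* v :+ x) :+ (d :* v :+ y)) refl

  lincomb-scaleˡ : ∀ a cs vs → lincomb L (map (a *_) cs) vs ≈ a * lincomb L cs vs
  lincomb-scaleˡ a []       _        = sym (zeroʳ a)
  lincomb-scaleˡ a (_ ∷ _)  []       = sym (zeroʳ a)
  lincomb-scaleˡ a (c ∷ cs) (v ∷ vs) =
    trans (+-congˡ (lincomb-scaleˡ a cs vs)) (factor a c v _)
    where
    factor : ∀ a c v x → (a * c) * v + a * x ≈ a * (c * v + x)
    factor = solve 4 (λ a c v x → (a :* c) :* v :+ a :* x := a :* (c :* v :+ x)) refl

  lincomb-scaleʳ : ∀ a cs vs → lincomb L cs (map (a *_) vs) ≈ a * lincomb L cs vs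
  lincomb-scaleʳ a []       _        = sym (zeroʳ a)
  lincomb-scaleʳ a (_ ∷ _)  []       = sym (zeroʳ a)
  lincomb-scaleʳ a (c ∷ cs) (v ∷ vs) =
    trans (+-congˡ (lincomb-scaleʳ a cs vs)) (factor a c v _)
    where
    factor : ∀ a c v x → c * (a * v) + a * x ≈ a * (c * v + x)
    factor = solve 4 (λ a c v x → c :* (a :* v) :+ a :* x := a :* (c :* v :+ x)) refl

  lincomb-replicate-0# : ∀ n vs → lincomb L (replicate n 0#) vs ≈ 0#
  lincomb-replicate-0# zero    _        = refl
  lincomb-replicate-0# (suc n) []       = refl
  lincomb-replicate-0# (suc n) (v ∷ vs) =
    trans (+-cong (zeroˡ v) (lincomb-replicate-0# n vs)) (+-identityˡ 0#)

  lincomb-∷ʳ : ∀ cs b vs v → length cs ≡ length vs →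
    lincomb L (cs ∷ʳ b) (vs ∷ʳ v) ≈ lincomb L cs vs + b * v
  lincomb-∷ʳ []       b []       v _  = trans (+-identityʳ (b * v)) (sym (+-identityˡ (b * v)))
  lincomb-∷ʳ (c ∷ cs) b (w ∷ vs) v eq =
    trans (+-congˡ (lincomb-∷ʳ cs b vs v (ℕₚ.suc-injective eq))) (sym (+-assoc (c * w) _ (b * v)))

module FieldProperties {c ℓ : Level} (L : CommutativeRing c ℓ) (isField : IsFieldCR L) where
  open CommutativeRing L hiding (zero)
  open SetoidReasoning setoid

  1#≉0# : ¬ 1# ≈ 0#
  1#≉0# = proj₁ isField

  x≉0⇒x*y≈0⇒y≈0 : ∀ {x y} → ¬ x ≈ 0# → x * y ≈ 0# → y ≈ 0#
  x≉0⇒x*y≈0⇒y≈0 {x} {y} x≉0 xy≈0 with proj₂ isField x x≉0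
  ... | x⁻¹ , xx⁻¹≈1 = begin
    y              ≈⟨ *-identityˡ y ⟨
    1# * y         ≈⟨ *-congʳ (trans (*-comm x⁻¹ x) xx⁻¹≈1) ⟨
    (x⁻¹ * x) * y  ≈⟨ *-assoc x⁻¹ x y ⟩
    x⁻¹ * (x * y)  ≈⟨ *-congˡ xy≈0 ⟩
    x⁻¹ * 0#       ≈⟨ zeroʳ x⁻¹ ⟩
    0#             ∎

  x*y≉0 : ∀ {x y} → ¬ x ≈ 0# → ¬ y ≈ 0# → ¬ x * y ≈ 0#
  x*y≉0 x≉0 y≉0 xy≈0 = y≉0 (x≉0⇒x*y≈0⇒y≈0 x≉0 xy≈0)

  *-cancelˡ : ∀ {x y z} → ¬ x ≈ 0# → x * y ≈ x * z → y ≈ z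
  *-cancelˡ {x} {y} {z} x≉0 xy≈xz =
    trans (+-inverseˡ-unique y (- z) (x≉0⇒x*y≈0⇒y≈0 x≉0 x[y-z]≈0)) (-‿involutive z)
    where
    open RingProperties ring using (+-inverseˡ-unique; -‿involutive; -‿distribʳ-*)
    x[y-z]≈0 : x * (y - z) ≈ 0#
    x[y-z]≈0 = begin
      x * (y - z)        ≈⟨ distribˡ x y (- z) ⟩
      x * y + x * - z    ≈⟨ +-cong xy≈xz (sym (-‿distribʳ-* x z)) ⟩
      x * z + - (x * z)  ≈⟨ -‿inverseʳ (x * z) ⟩
      0#                 ∎

module Powers {c ℓ : Level} (L : CommutativeRing c ℓ) where
  open CommutativeRing L hiding (zero)
  open SetoidMembership setoid using (_∈_)

  length-uvec : ∀ x d → length (uvec L x d) ≡ d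
  length-uvec x d = ≡.trans (length-map (pow L x) (upTo d)) (length-upTo d)

  uvec-∷ʳ : ∀ x d → uvec L x (suc d) ≡ uvec L x d ∷ʳ pow L x d
  uvec-∷ʳ x d = ≡.trans (cong (map (pow L x)) (≡.sym (upTo-∷ʳ d))) (map-++ (pow L x) (upTo d) (d ∷ []))

  ∈-uvec⁺ : ∀ x {j d} → j < d → pow L x j ∈ uvec L x d
  ∈-uvec⁺ x j<d =
    SetoidMembershipₚ.∈-map⁺ (≡.setoid ℕ) setoid (reflexive ∘ cong (pow L x)) (∈-upTo⁺ j<d)

  ∈-uvec⁻ : ∀ x {y d} → y ∈ uvec L x d → Σ ℕ λ j → j < d × y ≈ pow L x j
  ∈-uvec⁻ x y∈ with SetoidMembershipₚ.∈-map⁻ (≡.setoid ℕ) setoid y∈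
  ... | j , j∈upTo , y≈xʲ = j , ∈-upTo⁻ j∈upTo , y≈xʲ

  uvec-mono : ∀ x {y d e} → d ≤ e → y ∈ uvec L x d → y ∈ uvec L x e
  uvec-mono x d≤e y∈ with ∈-uvec⁻ x y∈
  ... | j , j<d , y≈xʲ =
    SetoidMembershipₚ.∈-resp-≈ setoid (sym y≈xʲ) (∈-uvec⁺ x (ℕₚ.<-≤-trans j<d d≤e))

  pow-+ : ∀ x a b → pow L x (a ℕ.+ b) ≈ pow L x a * pow L x b
  pow-+ x zero    b = sym (*-identityˡ _)
  pow-+ x (suc a) b = trans (*-congˡ (pow-+ x a b)) (sym (*-assoc _ _ _))

  uvec-all : ∀ {p} {P : Carrier → Set p} x d → (∀ {j} → j < d → P (pow L x j)) → All P (uvec L x d)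
  uvec-all x d P-pow = map⁺ (All.tabulate (P-pow ∘ ∈-upTo⁻))

module FiniteField {c ℓ : Level} (L : CommutativeRing c ℓ) (isField : IsFieldCR L)
                   {N : ℕ} (L-card : HasCard L (λ _ → ⊤) N) where
  open CommutativeRing L hiding (zero)
  open SetoidReasoning setoid
  open FieldProperties L isField
  open Powers L using (pow-+)

  element : Fin N → Carrier
  element = proj₁ L-card

  element-injective : ∀ i j → element i ≈ element j → i ≡ j
  element-injective = proj₁ (proj₂ (proj₂ L-card))

  index : Carrier → Fin N
  index x = proj₁ (proj₂ (proj₂ (proj₂ L-card)) x tt)

  element-index : ∀ x → x ≈ element (index x)
  element-index x = proj₂ (proj₂ (proj₂ (proj₂ L-card)) x tt)

  private
    ≈-index : ∀ {x y} → index x ≡ index y → x ≈ y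
    ≈-index {x} {y} eq = trans (element-index x) (trans (reflexive (cong element eq)) (sym (element-index y)))

  _≈?_ : Decidable _≈_
  x ≈? y with index x Finₚ.≟ index y
  ... | yes eq = yes (≈-index eq)
  ... | no neq = no λ x≈y → neq (element-injective _ _
                   (trans (sym (element-index x)) (trans x≈y (element-index y))))

  pow≉0 : ∀ {x} → ¬ x ≈ 0# → ∀ n → ¬ pow L x n ≈ 0#
  pow≉0 x≉0 zero    = 1#≉0#
  pow≉0 x≉0 (suc n) = x*y≉0 x≉0 (pow≉0 x≉0 n)

  -- Two of the powers x⁰, …, x^N coincide, say xᵃ = x^(a+1+p); cancelling xᵃ leaves x · xᵖ = 1.
  pow-inverse : ∀ {x} → ¬ x ≈ 0# → Σ ℕ λ p → x * pow L x p ≈ 1#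
  pow-inverse {x} x≉0 with pigeonhole (ℕₚ.n<1+n N) (λ i → index (pow L x (toℕ i)))
  ... | i , j , i<j , same-index = p , *-cancelˡ (pow≉0 x≉0 a) (begin
    pow L x a * pow L x (suc p) ≈⟨ pow-+ x a (suc p) ⟨
    pow L x (a ℕ.+ suc p)         ≡⟨ cong (pow L x) a+1+p≡b ⟩
    pow L x b                   ≈⟨ ≈-index same-index ⟨
    pow L x a                   ≈⟨ *-identityʳ _ ⟨
    pow L x a * 1#              ∎)
    where
    a = toℕ i
    b = toℕ j
    p = b ℕ.∸ suc a
    a+1+p≡b : a ℕ.+ suc p ≡ b
    a+1+p≡b = ≡.trans (ℕₚ.+-suc a p) (ℕₚ.m+[n∸m]≡n i<j)

module Spans {c ℓ : Level} (L : CommutativeRing c ℓ)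
             (K : CommutativeRing.Carrier L → Set ℓ) (K-subfield : IsSubfield L K) where
  open CommutativeRing L hiding (zero)
  open IsSubfield K-subfield
  open LinearCombination L
  open SetoidReasoning setoid
  open SetoidMembership setoid using (_∈_)

  Span : List Carrier → Carrier → Set (c ⊔ ℓ)
  Span = InSpan L K

  span-resp : ∀ {bs x y} → x ≈ y → Span bs x → Span bs y
  span-resp x≈y (cs , len , cs∈K , cs≈x) = cs , len , cs∈K , trans cs≈x x≈y

  span-0# : ∀ bs → Span bs 0#
  span-0# bs = replicate (length bs) 0# , length-replicate (length bs) ,
               replicate⁺ (length bs) has0 , lincomb-replicate-0# (length bs) bs

  private
    zipWith-+-∈K : ∀ {cs ds} → All K cs → All K ds → All K (zipWith _+_ cs ds)
    zipWith-+-∈K []         _          = []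
    zipWith-+-∈K (_ ∷ _)    []         = []
    zipWith-+-∈K (c ∷ cs∈K) (d ∷ ds∈K) = plus c d ∷ zipWith-+-∈K cs∈K ds∈K

  span-+ : ∀ {bs x y} → Span bs x → Span bs y → Span bs (x + y)
  span-+ {bs} (cs , cs-len , cs∈K , cs≈x) (ds , ds-len , ds∈K , ds≈y) =
    zipWith _+_ cs ds , len , zipWith-+-∈K cs∈K ds∈K ,
    trans (lincomb-zipWith-+ cs ds bs (≡.trans cs-len (≡.sym ds-len))) (+-cong cs≈x ds≈y)
    where
    len : length (zipWith _+_ cs ds) ≡ length bs
    len = ≡.trans (length-zipWith _+_ cs ds)
            (≡.trans (cong₂ ℕ._⊓_ cs-len ds-len) (ℕₚ.⊓-idem (length bs)))

  span-scale : ∀ {bs a x} → K a → Span bs x → Span bs (a * x)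
  span-scale {bs} {a} a∈K (cs , len , cs∈K , cs≈x) =
    map (a *_) cs , ≡.trans (length-map _ cs) len , map⁺ (All.map (times a∈K) cs∈K) ,
    trans (lincomb-scaleˡ a cs bs) (*-congˡ cs≈x)

  span-map-* : ∀ {bs y} a → Span bs y → Span (map (a *_) bs) (a * y)
  span-map-* {bs} a (cs , len , cs∈K , cs≈y) =
    cs , ≡.trans len (≡.sym (length-map _ bs)) , cs∈K , trans (lincomb-scaleʳ a cs bs) (*-congˡ cs≈y)

  span-lincomb : ∀ {bs ws cs} → All K cs → All (Span bs) ws → Span bs (lincomb L cs ws)
  span-lincomb {bs} {[]}    {[]}    _          _            = span-0# bs
  span-lincomb {bs} {[]}    {_ ∷ _} _          _            = span-0# bs
  span-lincomb {bs} {_ ∷ _} {[]}    _          _            = span-0# bs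
  span-lincomb {bs} {_ ∷ _} {_ ∷ _} (c ∷ cs∈K) (w∈ ∷ ws∈) =
    span-+ (span-scale c w∈) (span-lincomb cs∈K ws∈)

  span-⊆ : ∀ {bs ws y} → All (Span bs) ws → Span ws y → Span bs y
  span-⊆ ws∈ (cs , _ , cs∈K , cs≈y) = span-resp cs≈y (span-lincomb cs∈K ws∈)

  span-member : ∀ {bs y} → y ∈ bs → Span bs y
  span-member {b ∷ bs} {y} (here y≈b) =
    1# ∷ replicate (length bs) 0# , cong suc (length-replicate (length bs)) ,
    has1 ∷ replicate⁺ (length bs) has0 , (begin
      1# * b + lincomb L (replicate (length bs) 0#) bs
        ≈⟨ +-cong (*-identityˡ b) (lincomb-replicate-0# (length bs) bs) ⟩
      b + 0#  ≈⟨ +-identityʳ b ⟩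
      b       ≈⟨ y≈b ⟨
      y       ∎)
  span-member {b ∷ bs} {y} (there y∈bs) with span-member y∈bs
  ... | cs , len , cs∈K , cs≈y =
    0# ∷ cs , cong suc len , has0 ∷ cs∈K , trans (+-cong (zeroˡ b) cs≈y) (+-identityˡ y)

  coordinates-unique : ∀ {bs cs ds} → Independent L K bs →
    length cs ≡ length bs → length ds ≡ length bs → All K cs → All K ds →
    lincomb L cs bs ≈ lincomb L ds bs → Pointwise _≈_ cs ds
  coordinates-unique {bs} {cs} {ds} independent cs-len ds-len cs∈K ds∈K cs≈ds =
    differences-vanish cs ds (≡.trans cs-len (≡.sym ds-len))
      (independent differences len (zipWith-+-∈K cs∈K (map⁺ (All.map (times (neg has1)) ds∈K))) (begin
        lincomb L differences bs
          ≈⟨ lincomb-zipWith-+ cs _ bs (≡.trans cs-len (≡.sym ds′-len)) ⟩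
        lincomb L cs bs + lincomb L (map (- 1# *_) ds) bs ≈⟨ +-cong cs≈ds (lincomb-scaleˡ (- 1#) ds bs) ⟩
        lincomb L ds bs + - 1# * lincomb L ds bs        ≈⟨ +-congˡ (-1*x≈-x _) ⟩
        lincomb L ds bs - lincomb L ds bs               ≈⟨ -‿inverseʳ _ ⟩
        0#                                              ∎))
    where
    open RingProperties ring using (-1*x≈-x; +-inverseˡ-unique; -‿involutive)
    differences : List Carrier
    differences = zipWith _+_ cs (map (- 1# *_) ds)
    ds′-len : length (map (- 1# *_) ds) ≡ length bs
    ds′-len = ≡.trans (length-map _ ds) ds-len
    len : length differences ≡ length bs
    len = ≡.trans (length-zipWith _+_ cs _)
            (≡.trans (cong₂ ℕ._⊓_ cs-len ds′-len) (ℕₚ.⊓-idem (length bs)))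
    differences-vanish : ∀ cs ds → length cs ≡ length ds →
      All (_≈ 0#) (zipWith _+_ cs (map (- 1# *_) ds)) → Pointwise _≈_ cs ds
    differences-vanish []       []       _  _                 = []
    differences-vanish (c ∷ cs) (d ∷ ds) eq (c-d≈0 ∷ rest) =
      trans (+-inverseˡ-unique c _ c-d≈0) (trans (-‿cong (-1*x≈-x d)) (-‿involutive d))
      ∷ differences-vanish cs ds (ℕₚ.suc-injective eq) rest

  independent-∷ʳ : (∀ x → Dec (x ≈ 0#)) → ∀ {bs v} → Independent L K bs → ¬ Span bs v →
    Independent L K (bs ∷ʳ v)
  independent-∷ʳ _≈0? {bs} {v} independent v∉span cs len cs∈K comb≈0 with initLast cs
  ... | []        = contradiction (≡.sym (≡.trans len (length-++ bs))) (ℕₚ.m+1+n≢0 (length bs))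
  ... | cs′ ∷ʳ′ b = last-coefficient (∷ʳ⁻ cs∈K) (b ≈0?)
    where
    open RingProperties ring using (+-inverseʳ-unique; -‿distribˡ-*; -‿distribʳ-*)
    len′ : length cs′ ≡ length bs
    len′ = length-∷ʳ-injective cs′ bs len
    X = lincomb L cs′ bs
    X+bv≈0 : X + b * v ≈ 0#
    X+bv≈0 = trans (sym (lincomb-∷ʳ cs′ b bs v len′)) comb≈0
    last-coefficient : All K cs′ × K b → Dec (b ≈ 0#) → All (_≈ 0#) (cs′ ∷ʳ b)
    last-coefficient (cs′∈K , _) (yes b≈0) = ∷ʳ⁺ (independent cs′ len′ cs′∈K X≈0) b≈0
      where
      X≈0 : X ≈ 0#
      X≈0 = begin
        X           ≈⟨ +-identityʳ X ⟨
        X + 0#      ≈⟨ +-congˡ (trans (*-congʳ b≈0) (zeroˡ v)) ⟨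
        X + b * v   ≈⟨ X+bv≈0 ⟩
        0#          ∎
    last-coefficient (cs′∈K , b∈K) (no b≉0) with inv b∈K b≉0
    ... | b⁻¹ , b⁻¹∈K , bb⁻¹≈1 =
      contradiction (span-resp v≈ (span-scale (neg b⁻¹∈K) (cs′ , len′ , cs′∈K , refl))) v∉span
      where
      v≈ : - b⁻¹ * X ≈ v
      v≈ = begin
        - b⁻¹ * X      ≈⟨ -‿distribˡ-* b⁻¹ X ⟨
        - (b⁻¹ * X)    ≈⟨ -‿distribʳ-* b⁻¹ X ⟩
        b⁻¹ * - X      ≈⟨ *-congˡ (+-inverseʳ-unique X (b * v) X+bv≈0) ⟨
        b⁻¹ * (b * v)  ≈⟨ *-assoc b⁻¹ b v ⟨
        (b⁻¹ * b) * v  ≈⟨ *-congʳ (trans (*-comm b⁻¹ b) bb⁻¹≈1) ⟩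
        1# * v         ≈⟨ *-identityˡ v ⟩
        v              ∎

module Counting {c ℓ : Level} (L : CommutativeRing c ℓ)
                (K : CommutativeRing.Carrier L → Set ℓ) (K-subfield : IsSubfield L K)
                {q : ℕ} (K-card : HasCard L K q) where
  open CommutativeRing L hiding (zero)
  open IsSubfield K-subfield
  open LinearCombination L
  open Spans L K K-subfield

  private
    scalar : Fin q → Carrier
    scalar = proj₁ K-card

    scalar∈K : ∀ i → K (scalar i)
    scalar∈K = proj₁ (proj₂ K-card)

    scalar-injective : ∀ i j → scalar i ≈ scalar j → i ≡ j
    scalar-injective = proj₁ (proj₂ (proj₂ K-card))

    scalar-index : ∀ x → K x → Σ (Fin q) λ i → x ≈ scalar i
    scalar-index = proj₂ (proj₂ (proj₂ K-card))

    digits : ∀ {d} → Fin (q ^ d) → Fin d → Fin q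
    digits {d} = finToFun {q} {d}

    coefficients : ∀ d → Fin (q ^ d) → List Carrier
    coefficients d i = tabulate (scalar ∘ digits {d} i)

    coefficients∈K : ∀ d i → All K (coefficients d i)
    coefficients∈K d i = tabulate⁺ (scalar∈K ∘ digits {d} i)

  ≈-injection⇒≤ : ∀ {A B} (f : Fin A → Carrier) (g : Fin B → Carrier) →
    (∀ i j → f i ≈ f j → i ≡ j) → (∀ i → Σ (Fin B) λ j → f i ≈ g j) → A ≤ B
  ≈-injection⇒≤ f g f-injective f⊆g = injective⇒≤ {f = proj₁ ∘ f⊆g} λ {i} {j} same →
    f-injective i j (trans (proj₂ (f⊆g i)) (trans (reflexive (cong g same)) (sym (proj₂ (f⊆g j)))))

  1#≉0#⇒1<q : ¬ 1# ≈ 0# → 1 < q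
  1#≉0#⇒1<q 1#≉0# = ≈-injection⇒≤ zero-or-one scalar injective (λ i → scalar-index _ (∈K i))
    where
    zero-or-one : Fin 2 → Carrier
    zero-or-one Fin.zero       = 0#
    zero-or-one (Fin.suc _)    = 1#
    ∈K : ∀ i → K (zero-or-one i)
    ∈K Fin.zero    = has0
    ∈K (Fin.suc _) = has1
    injective : ∀ i j → zero-or-one i ≈ zero-or-one j → i ≡ j
    injective Fin.zero                Fin.zero                _   = ≡.refl
    injective Fin.zero                (Fin.suc Fin.zero)      0≈1 = ⊥-elim (1#≉0# (sym 0≈1))
    injective (Fin.suc Fin.zero)      Fin.zero                1≈0 = ⊥-elim (1#≉0# 1≈0)
    injective (Fin.suc Fin.zero)      (Fin.suc Fin.zero)      _   = ≡.refl

  -- The base-q digits of i choose the coefficients, via the enumeration of K.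
  enum : (bs : List Carrier) → Fin (q ^ length bs) → Carrier
  enum bs i = lincomb L (coefficients (length bs) i) bs

  enum-span : ∀ bs i → Span bs (enum bs i)
  enum-span bs i = coefficients (length bs) i , length-tabulate _ , coefficients∈K (length bs) i , refl

  private
    indices : ∀ {cs} → All K cs → Fin (length cs) → Fin q
    indices (c∈K ∷ _)     Fin.zero    = proj₁ (scalar-index _ c∈K)
    indices (_ ∷ cs∈K)    (Fin.suc i) = indices cs∈K i

    indices-correct : ∀ {cs} (cs∈K : All K cs) → Pointwise _≈_ cs (tabulate (scalar ∘ indices cs∈K))
    indices-correct []         = []
    indices-correct (c∈K ∷ cs∈K) = proj₂ (scalar-index _ c∈K) ∷ indices-correct cs∈K

    coefficients-index : ∀ d {cs} → length cs ≡ d → All K cs →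
      Σ (Fin (q ^ d)) λ i → Pointwise _≈_ cs (coefficients d i)
    coefficients-index _ ≡.refl cs∈K =
      funToFin (indices cs∈K) ,
      ≡.subst (Pointwise _≈_ _)
        (tabulate-cong (λ i → cong scalar (≡.sym (finToFun-funToFin {n = q} (indices cs∈K) i))))
        (indices-correct cs∈K)

  span⇒enum : ∀ {bs y} → Span bs y → Σ (Fin (q ^ length bs)) λ i → y ≈ enum bs i
  span⇒enum {bs} (cs , len , cs∈K , cs≈y) with coefficients-index (length bs) len cs∈K
  ... | i , cs≈i = i , trans (sym cs≈y) (lincomb-cong bs cs≈i)

  enum-injective : ∀ {bs} → Independent L K bs → ∀ i j → enum bs i ≈ enum bs j → i ≡ j
  enum-injective {bs} independent i j i≈j = begin
    i                        ≡⟨ funToFin-finToFin {d} {q} i ⟨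
    funToFin (digits {d} i)  ≡⟨ funToFin-cong {d} {q} same-digits ⟩
    funToFin (digits {d} j)  ≡⟨ funToFin-finToFin {d} {q} j ⟩
    j                        ∎
    where
    open ≡.≡-Reasoning
    d : ℕ
    d = length bs
    same-digits : ∀ k → digits {d} i k ≡ digits j k
    same-digits k = scalar-injective _ _
      (Pointwise.tabulate⁻ {f = scalar ∘ digits {d} i} {g = scalar ∘ digits {d} j}
        (coordinates-unique independent (length-tabulate _) (length-tabulate _)
          (coefficients∈K d i) (coefficients∈K d j) i≈j) k)

  independent-card : ∀ {ws B} → Independent L K ws → (g : Fin B → Carrier) →
    (∀ {y} → Span ws y → Σ (Fin B) λ j → y ≈ g j) → q ^ length ws ≤ B
  independent-card {ws} independent g covers =
    ≈-injection⇒≤ (enum ws) g (enum-injective independent) (covers ∘ enum-span ws)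

  independent-length-≤ : ∀ {ws bs} → 1 < q → Independent L K ws → All (Span bs) ws →
    length ws ≤ length bs
  independent-length-≤ {ws} {bs} 1<q independent ws⊆bs =
    ^-cancelʳ-≤ 1<q (independent-card independent (enum bs) (span⇒enum ∘ span-⊆ ws⊆bs))

module GeneratorPowers {c ℓ : Level} (L : CommutativeRing c ℓ) (isField : IsFieldCR L)
    (K : CommutativeRing.Carrier L → Set ℓ) (K-subfield : IsSubfield L K)
    {q : ℕ} (K-card : HasCard L K q) {m : ℕ} (L-card : HasCard L (λ _ → ⊤) (q ^ m))
    (λ₀ : CommutativeRing.Carrier L) (generates : Generates L K λ₀) where
  open CommutativeRing L hiding (zero)
  open IsSubfield K-subfield
  open RingProperties ring using (-1*x≈-x)
  open FieldProperties L isField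
  open FiniteField L isField L-card
  open Spans L K K-subfield
  open Counting L K K-subfield K-card
  open Powers L

  u : ℕ → List Carrier
  u = uvec L λ₀

  module PowerSpan {D : ℕ} (1≤D : 1 ≤ D) (λᴰ-span : Span (u D) (pow L λ₀ D)) where
    1#-span : Span (u D) 1#
    1#-span = span-member (∈-uvec⁺ λ₀ 1≤D)

    λ*-closed : ∀ {y} → Span (u D) y → Span (u D) (λ₀ * y)
    λ*-closed y-span = span-⊆ (map⁺ (uvec-all λ₀ D next-power)) (span-map-* λ₀ y-span)
      where
      next-power : ∀ {j} → j < D → Span (u D) (pow L λ₀ (suc j))
      next-power {j} j<D with ℕₚ.m≤n⇒m<n∨m≡n j<D
      ... | inj₁ 1+j<D = span-member (∈-uvec⁺ λ₀ 1+j<D)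
      ... | inj₂ 1+j≡D = ≡.subst (Span (u D) ∘ pow L λ₀) (≡.sym 1+j≡D) λᴰ-span

    pow*-closed : ∀ j {y} → Span (u D) y → Span (u D) (pow L λ₀ j * y)
    pow*-closed zero    y-span = span-resp (sym (*-identityˡ _)) y-span
    pow*-closed (suc j) y-span = span-resp (sym (*-assoc λ₀ _ _)) (λ*-closed (pow*-closed j y-span))

    *-closed : ∀ {x y} → Span (u D) x → Span (u D) y → Span (u D) (x * y)
    *-closed {x} {y} x-span y-span =
      span-resp (*-comm y x) (span-⊆ (map⁺ (uvec-all λ₀ D y*λʲ-span)) (span-map-* y x-span))
      where
      y*λʲ-span : ∀ {j} → j < D → Span (u D) (y * pow L λ₀ j)
      y*λʲ-span {j} _ = span-resp (*-comm _ y) (pow*-closed j y-span)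

    -- Span (u D) at universe level ℓ, as required by IsSubfield and Generates.
    InPowerSpan : Carrier → Set ℓ
    InPowerSpan y = Σ (Fin (q ^ length (u D))) λ i → y ≈ enum (u D) i

    private
      from : ∀ {y} → InPowerSpan y → Span (u D) y
      from (i , y≈i) = span-resp (sym y≈i) (enum-span (u D) i)

      pow-closed : ∀ {x} → Span (u D) x → ∀ p → Span (u D) (pow L x p)
      pow-closed x-span zero    = 1#-span
      pow-closed x-span (suc p) = *-closed x-span (pow-closed x-span p)

    power-span-subfield : IsSubfield L InPowerSpan
    power-span-subfield = record
      { resp  = λ { x≈y (i , x≈i) → i , trans (sym x≈y) x≈i }
      ; has0  = span⇒enum (span-0# (u D))
      ; has1  = span⇒enum 1#-span
      ; plus  = λ x y → span⇒enum (span-+ (from x) (from y))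
      ; neg   = λ x → span⇒enum (span-resp (-1*x≈-x _) (span-scale (neg has1) (from x)))
      ; times = λ x y → span⇒enum (*-closed (from x) (from y))
      ; inv   = λ {x} x-in x≉0 → let p , xxᵖ≈1 = pow-inverse x≉0 in
                  pow L x p , span⇒enum (pow-closed (from x-in) p) , xxᵖ≈1
      }

    everything-in-power-span : ∀ y → InPowerSpan y
    everything-in-power-span = generates InPowerSpan power-span-subfield
      (λ a a∈K → span⇒enum (span-resp (*-identityʳ a) (span-scale a∈K 1#-span)))
      (span⇒enum (span-resp (*-identityʳ λ₀) (λ*-closed 1#-span)))

  generator-degree : ∀ {D} → Span (u D) (pow L λ₀ D) → m ≤ D
  generator-degree {zero}  ([]    , _  , _ , 0≈1) = ⊥-elim (1#≉0# (sym 0≈1))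
  generator-degree {zero}  (_ ∷ _ , () , _)
  generator-degree {suc D} λᴰ-span = ^-cancelʳ-≤ (1#≉0#⇒1<q 1#≉0#)
    (≡.subst (λ d → q ^ m ≤ q ^ d) (length-uvec λ₀ (suc D))
      (≈-injection⇒≤ element (enum (u (suc D))) element-injective (everything-in-power-span ∘ element)))
    where open PowerSpan (s≤s z≤n) λᴰ-span

  powers-independent : ∀ {d} → d ≤ m → Independent L K (u d)
  powers-independent {zero}  _   []      _  _ _ = []
  powers-independent {zero}  _   (_ ∷ _) () _ _
  powers-independent {suc d} d<m = ≡.subst (Independent L K) (≡.sym (uvec-∷ʳ λ₀ d))
    (independent-∷ʳ (_≈? 0#) (powers-independent (ℕₚ.<⇒≤ d<m))
      (λ λᵈ-span → ℕₚ.<⇒≱ d<m (generator-degree λᵈ-span)))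

-- Codewords supported on a suffix T realise every weight in [h, sum T]; the bound x ≤ 1 + sum T lets
-- a further block of length x extend this interval to [h, x + sum T] without a gap.
data Gapless (h : ℕ) : List ℕ → Set where
  end  : Gapless h (h ∷ [])
  cons : ∀ {x T} → h ≤ x → x ≤ suc (sum T) → Gapless h T → Gapless h (x ∷ T)

gapless-≥ : ∀ {h T} → Gapless h T → All (h ≤_) T
gapless-≥ end              = ℕₚ.≤-refl ∷ []
gapless-≥ (cons h≤x _ rest) = h≤x ∷ gapless-≥ rest

gapless-sum-≥ : ∀ {h T} → Gapless h T → h ≤ sum T
gapless-sum-≥ {h} end                   = ℕₚ.m≤m+n h 0
gapless-sum-≥ (cons {x} {T} h≤x _ _) = ℕₚ.≤-trans h≤x (ℕₚ.m≤m+n x (sum T))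

record Admissible (k n m h : ℕ) (T : List ℕ) : Set where
  field
    length≡ : length T ≡ k
    sum≡    : sum T ≡ n
    ≤m      : All (_≤ m) T
    gapless : Gapless h T
    1≤h     : 1 ≤ h

offset-< : ∀ {n r′ i} → n ≤ r′ → i < n → r′ ℕ.∸ n ℕ.+ i < r′
offset-< {n} {r′} {i} n≤r′ i<n =
  ≡.subst (r′ ℕ.∸ n ℕ.+ i <_) (ℕₚ.m∸n+n≡m n≤r′) (ℕₚ.+-monoʳ-< (r′ ℕ.∸ n) i<n)

offset-split : ∀ {n r r′ j} → n ≤ r′ → r′ ≤ r ℕ.+ n → r ≤ j → j < r′ →
  Σ ℕ λ i → i < n × j ≡ r′ ℕ.∸ n ℕ.+ i
offset-split {n} {r} {r′} {j} n≤r′ r′≤r+n r≤j j<r′ = j ℕ.∸ s , j-s<n , ≡.sym (ℕₚ.m+[n∸m]≡n s≤j)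
  where
  s = r′ ℕ.∸ n
  s≤j : s ≤ j
  s≤j = ℕₚ.≤-trans (ℕₚ.m≤n+o⇒m∸n≤o r′ n (≡.subst (r′ ≤_) (ℕₚ.+-comm r n) r′≤r+n)) r≤j
  j-s<n : j ℕ.∸ s < n
  j-s<n = ℕₚ.+-cancelˡ-< s (j ℕ.∸ s) n
    (≡.subst₂ _<_ (≡.sym (ℕₚ.m+[n∸m]≡n s≤j)) (≡.sym (ℕₚ.m∸n+n≡m n≤r′)) j<r′)

module CodeWeights {c ℓ : Level} (L : CommutativeRing c ℓ) (isField : IsFieldCR L)
    (K : CommutativeRing.Carrier L → Set ℓ) (K-subfield : IsSubfield L K)
    {q : ℕ} (K-card : HasCard L K q) {m : ℕ} (L-card : HasCard L (λ _ → ⊤) (q ^ m))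
    (λ₀ : CommutativeRing.Carrier L)
    (powers-independent : ∀ {d} → d ≤ m → Independent L K (uvec L λ₀ d)) where
  open CommutativeRing L hiding (zero)
  open SetoidMembership setoid using (_∈_)
  open SetoidMembershipₚ using (∈-resp-≈; ∈-++⁺ˡ; ∈-++⁺ʳ; ∈-map⁺)
  open LinearCombination L
  open FieldProperties L isField
  open FiniteField L isField L-card
  open Spans L K K-subfield
  open Counting L K K-subfield K-card
  open Powers L

  u : ℕ → List Carrier
  u = uvec L λ₀

  cw : List ℕ → List Carrier → List Carrier
  cw = codeword L λ₀

  1<q : 1 < q
  1<q = 1#≉0#⇒1<q 1#≉0#

  rank-weight-≤ : ∀ {v r} → RankWeight L K v r → r ≤ m
  rank-weight-≤ (bs , ≡.refl , independent , _ , _) =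
    ^-cancelʳ-≤ 1<q (independent-card independent element (λ {y} _ → index y , element-index y))

  block-independent : ∀ {x n} → ¬ x ≈ 0# → n ≤ m → Independent L K (map (x *_) (u n))
  block-independent {x} {n} x≉0 n≤m cs len cs∈K comb≈0 =
    powers-independent n≤m cs (≡.trans len (length-map _ (u n))) cs∈K
      (x≉0⇒x*y≈0⇒y≈0 x≉0 (trans (sym (lincomb-scaleʳ x cs (u n))) comb≈0))

  weight-≥ : ∀ {h bs} T xs → length xs ≡ length T → All (h ≤_) T → All (_≤ m) T →
    ¬ IsZeroVec L (cw T xs) → All (Span bs) (cw T xs) → h ≤ length bs
  weight-≥ []      []       _   _            _            nonzero _ = ⊥-elim (nonzero [])
  weight-≥ {h} {bs} (n ∷ T) (x ∷ xs) len (h≤n ∷ h≤T) (n≤m ∷ T≤m) nonzero spans with x ≈? 0#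
  ... | yes x≈0 =
    weight-≥ T xs (ℕₚ.suc-injective len) h≤T T≤m (nonzero ∘ ++⁺ zero-block) (++⁻ʳ _ spans)
    where
    zero-block : IsZeroVec L (map (x *_) (u n))
    zero-block = map⁺ (All.universal (λ y → trans (*-congʳ x≈0) (zeroˡ y)) (u n))
  ... | no  x≉0 = ℕₚ.≤-trans h≤n (≡.subst (_≤ length bs) (≡.trans (length-map _ (u n)) (length-uvec λ₀ n))
                    (independent-length-≤ 1<q (block-independent x≉0 n≤m) (++⁻ˡ _ spans)))

  -- Such a codeword has rank weight r, with basis 1, λ, …, λ^(r-1).
  record PowerCodeword (T : List ℕ) (r : ℕ) : Set (c ⊔ ℓ) where
    field
      message : List Carrier
      length≡ : length message ≡ length T
      entries : All (λ y → y ≈ 0# ⊎ y ∈ u r) (cw T message)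
      covers  : ∀ {j} → j < r → pow L λ₀ j ∈ cw T message

  power-codeword-[] : PowerCodeword [] 0
  power-codeword-[] = record { message = [] ; length≡ = ≡.refl ; entries = [] ; covers = λ () }

  power-codeword-skip : ∀ {n T r} → PowerCodeword T r → PowerCodeword (n ∷ T) r
  power-codeword-skip {n} P = record
    { message = 0# ∷ message
    ; length≡ = cong suc length≡
    ; entries = ++⁺ (map⁺ (All.universal (λ y → inj₁ (zeroˡ y)) (u n))) entries
    ; covers  = ∈-++⁺ʳ setoid _ ∘ covers
    }
    where open PowerCodeword P

  -- The new block carries λ^s, …, λ^(r′-1) for s = r′ - n, which together with 1, …, λ^(r-1) from
  -- the tail covers every power below r′ because s ≤ r.
  power-codeword-extend : ∀ {n T r r′} → PowerCodeword T r → n ≤ r′ → r ≤ r′ → r′ ≤ r ℕ.+ n →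
    PowerCodeword (n ∷ T) r′
  power-codeword-extend {n} {T} {r} {r′} P n≤r′ r≤r′ r′≤r+n = record
    { message = pow L λ₀ s ∷ message
    ; length≡ = cong suc length≡
    ; entries = ++⁺ (map⁺ (uvec-all λ₀ n (inj₂ ∘ block-entry)))
                    (All.map (Sum.map₂ (uvec-mono λ₀ r≤r′)) entries)
    ; covers  = covers′
    }
    where
    open PowerCodeword P
    s = r′ ℕ.∸ n
    block-entry : ∀ {i} → i < n → pow L λ₀ s * pow L λ₀ i ∈ u r′
    block-entry i<n = ∈-resp-≈ setoid (pow-+ λ₀ s _) (∈-uvec⁺ λ₀ (offset-< n≤r′ i<n))
    in-block : ∀ {i} → i < n → pow L λ₀ (s ℕ.+ i) ∈ map (pow L λ₀ s *_) (u n)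
    in-block i<n = ∈-resp-≈ setoid (sym (pow-+ λ₀ s _)) (∈-map⁺ setoid setoid *-congˡ (∈-uvec⁺ λ₀ i<n))
    covers′ : ∀ {j} → j < r′ → pow L λ₀ j ∈ cw (n ∷ T) (pow L λ₀ s ∷ message)
    covers′ {j} j<r′ with j ℕₚ.<? r
    ... | yes j<r = ∈-++⁺ʳ setoid _ (covers j<r)
    ... | no  j≮r with offset-split n≤r′ r′≤r+n (ℕₚ.≮⇒≥ j≮r) j<r′
    ...   | i , i<n , j≡s+i =
      ∈-++⁺ˡ setoid (≡.subst (λ e → pow L λ₀ e ∈ map (pow L λ₀ s *_) (u n)) (≡.sym j≡s+i) (in-block i<n))

  gapless⇒power-codeword : ∀ {h T r} → Gapless h T → h ≤ r → r ≤ sum T → PowerCodeword T r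
  gapless⇒power-codeword {h} {r = r} end h≤r r≤h+0 =
    power-codeword-extend power-codeword-[] h≤r z≤n (≡.subst (r ≤_) (ℕₚ.+-identityʳ h) r≤h+0)
  gapless⇒power-codeword {r = r} (cons {x} {T} _ x≤1+ΣT rest) h≤r r≤x+ΣT with r ℕₚ.≤? sum T
  ... | yes r≤ΣT = power-codeword-skip (gapless⇒power-codeword rest h≤r r≤ΣT)
  ... | no  r≰ΣT = power-codeword-extend (gapless⇒power-codeword rest (gapless-sum-≥ rest) ℕₚ.≤-refl)
                     (ℕₚ.≤-trans x≤1+ΣT ΣT<r) (ℕₚ.<⇒≤ ΣT<r) (≡.subst (r ≤_) (ℕₚ.+-comm x (sum T)) r≤x+ΣT)
    where
    ΣT<r : sum T < r
    ΣT<r = ℕₚ.≰⇒> r≰ΣT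

  power-codeword⇒weight : ∀ {T r} → 1 ≤ r → r ≤ m → PowerCodeword T r → InWS L K λ₀ T r
  power-codeword⇒weight {T} {r} 1≤r r≤m P =
    message , length≡ , nonzero ,
    u r , length-uvec λ₀ r , powers-independent r≤m , uvec-all λ₀ r (span-member ∘ covers) ,
    All.map [ (λ y≈0 → span-resp (sym y≈0) (span-0# (u r))) , span-member ]′ entries
    where
    open PowerCodeword P
    nonzero : ¬ IsZeroVec L (cw T message)
    nonzero zeros = 1#≉0# (All.lookupₛ setoid (λ x≈y x≈0 → trans (sym x≈y) x≈0) zeros (covers 1≤r))

  rows-independent : ∀ T xs → All (1 ≤_) T → length xs ≡ length T →
    IsZeroVec L (cw T xs) → IsZeroVec L xs
  rows-independent []          []       _            _   _                = []
  rows-independent (zero  ∷ T) (x ∷ xs) (() ∷ _)     _   _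
  rows-independent (suc n ∷ T) (x ∷ xs) (_ ∷ 1≤T)    len (x*1≈0 ∷ zeros) =
    trans (sym (*-identityʳ x)) x*1≈0 ∷ rows-independent T xs 1≤T (ℕₚ.suc-injective len) (++⁻ʳ _ zeros)

  weight-spectrum : ∀ {k n h T} → Admissible k n m h T → m ≤ n →
      IsCodeParams L λ₀ T n k m
    × (∀ r → InWS L K λ₀ T r → h ≤ r × r ≤ m)
    × (∀ r → h ≤ r → r ≤ m → InWS L K λ₀ T r)
  weight-spectrum {h = h} {T} admissible m≤n =
    (length≡ , sum≡ , All.zip (1≤T , ≤m) , (λ xs len → rows-independent T xs 1≤T len)) ,
    (λ { r (xs , len , nonzero , rank@(bs , |bs|≡r , _ , _ , cw⊆bs)) →
           ≡.subst (h ≤_) |bs|≡r (weight-≥ T xs len h≤T ≤m nonzero cw⊆bs) , rank-weight-≤ rank }) ,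
    (λ r h≤r r≤m → power-codeword⇒weight (ℕₚ.≤-trans 1≤h h≤r) r≤m
       (gapless⇒power-codeword gapless h≤r (≡.subst (r ≤_) (≡.sym sum≡) (ℕₚ.≤-trans r≤m m≤n))))
    where
    open Admissible admissible
    h≤T : All (h ≤_) T
    h≤T = gapless-≥ gapless
    1≤T : All (1 ≤_) T
    1≤T = All.map (ℕₚ.≤-trans 1≤h) h≤T

open import Data.Nat using (_+_; _*_; _∸_)
open ℕₚ
open ≡ using (refl; sym; trans; subst; subst₂)

div≡/ : ∀ x y .{{_ : NonZero y}} → x div y ≡ x / y
div≡/ x (suc y) = refl

private
  2^≢0 : ∀ i → NonZero (2 ^ i)
  2^≢0 i = m^n≢0 2 i

div-2^-suc : ∀ u i → u div (2 ^ suc i) ≡ (u div 2) div (2 ^ i)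
div-2^-suc u i = begin
  u div (2 ^ suc i)      ≡⟨ div≡/ u (2 ^ suc i) ⟩
  u / (2 * 2 ^ i)        ≡⟨ m/n/o≡m/[n*o] u 2 (2 ^ i) ⟨
  (u / 2) / (2 ^ i)      ≡⟨ div≡/ (u / 2) (2 ^ i) ⟨
  (u div 2) div (2 ^ i)  ∎
  where
  open ≡.≡-Reasoning
  instance
    _ = 2^≢0 i
    _ = 2^≢0 (suc i)

div-2≡⌊/2⌋ : ∀ u → u div 2 ≡ ⌊ u /2⌋
div-2≡⌊/2⌋ zero          = refl
div-2≡⌊/2⌋ (suc zero)    = refl
div-2≡⌊/2⌋ (suc (suc u)) =
  trans (m/n≡1+[m∸n]/n {suc (suc u)} {2} (s≤s (s≤s z≤n))) (cong suc (div-2≡⌊/2⌋ u))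

div-2^-≤ : ∀ u i → u div (2 ^ i) ≤ u
div-2^-≤ u i = subst (_≤ u) (sym (div≡/ u (2 ^ i) {{2^≢0 i}})) (m/n≤m u (2 ^ i) {{2^≢0 i}})

div-2^-≥1 : ∀ {u i} → 2 ^ i ≤ u → 1 ≤ u div (2 ^ i)
div-2^-≥1 {u} {i} 2ⁱ≤u =
  subst (1 ≤_) (sym (div≡/ u (2 ^ i) {{2^≢0 i}})) (m≥n⇒m/n>0 {{2^≢0 i}} 2ⁱ≤u)

div-2^-≡0 : ∀ {u i} → u < 2 ^ i → u div (2 ^ i) ≡ 0
div-2^-≡0 {u} {i} u<2ⁱ = trans (div≡/ u (2 ^ i) {{2^≢0 i}}) (m<n⇒m/n≡0 {{2^≢0 i}} u<2ⁱ)

div-2^-≤1 : ∀ {u i} → u < 2 ^ suc i → u div (2 ^ i) ≤ 1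
div-2^-≤1 {u} {i} u<2ⁱ⁺¹ = subst (_≤ 1) (sym (div≡/ u (2 ^ i) {{2^≢0 i}}))
  (s≤s⁻¹ (m<n*o⇒m/o<n {u} {2} {2 ^ i} {{2^≢0 i}} u<2ⁱ⁺¹))

⌈/2⌉≤1+⌊/2⌋ : ∀ u → ⌈ u /2⌉ ≤ suc ⌊ u /2⌋
⌈/2⌉≤1+⌊/2⌋ zero          = z≤n
⌈/2⌉≤1+⌊/2⌋ (suc zero)    = s≤s z≤n
⌈/2⌉≤1+⌊/2⌋ (suc (suc u)) = s≤s (⌈/2⌉≤1+⌊/2⌋ u)

⌈/2⌉≤ : ∀ {u m} → u ≤ m + m → ⌈ u /2⌉ ≤ m
⌈/2⌉≤ {u} {m} u≤2m = ≤-trans (⌈n/2⌉-mono u≤2m) (≤-reflexive (⌈m+m/2⌉≡m m))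
  where
  ⌈m+m/2⌉≡m : ∀ m → ⌈ (m + m) /2⌉ ≡ m
  ⌈m+m/2⌉≡m zero    = refl
  ⌈m+m/2⌉≡m (suc m) = trans (cong (λ x → ⌈ suc x /2⌉) (+-suc m m)) (cong suc (⌈m+m/2⌉≡m m))

Ψ-step : ∀ u j → Ψ u (2 + j) ≡ ⌈ u /2⌉ ∷ Ψ (u div 2) (1 + j)
Ψ-step u j = begin
  ⌈ u div 1 /2⌉ ∷ map f (applyUpTo suc j) ++ u div (2 ^ suc j) ∷ []
    ≡⟨ cong₂ (λ x xs → ⌈ x /2⌉ ∷ xs ++ u div (2 ^ suc j) ∷ []) (n/1≡n u) tail-eq ⟩
  ⌈ u /2⌉ ∷ map g (upTo j) ++ u div (2 ^ suc j) ∷ []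
    ≡⟨ cong (λ x → ⌈ u /2⌉ ∷ map g (upTo j) ++ x ∷ []) (div-2^-suc u j) ⟩
  ⌈ u /2⌉ ∷ map g (upTo j) ++ (u div 2) div (2 ^ j) ∷ [] ∎
  where
  open ≡.≡-Reasoning
  f g : ℕ → ℕ
  f i = ⌈ u div (2 ^ i) /2⌉
  g i = ⌈ (u div 2) div (2 ^ i) /2⌉
  tail-eq : map f (applyUpTo suc j) ≡ map g (upTo j)
  tail-eq = begin
    map f (applyUpTo suc j)   ≡⟨ cong (map f) (map-upTo suc j) ⟨
    map f (map suc (upTo j))  ≡⟨ map-∘ (upTo j) ⟨
    map (f ∘ suc) (upTo j)    ≡⟨ map-cong (λ i → cong ⌈_/2⌉ (div-2^-suc u i)) (upTo j) ⟩
    map g (upTo j)            ∎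

length-Ψ : ∀ u j → length (Ψ u (suc j)) ≡ suc j
length-Ψ u j = trans (length-++ (map _ (upTo j)))
  (trans (cong (_+ 1) (trans (length-map _ (upTo j)) (length-upTo j))) (+-comm j 1))

sum-Ψ : ∀ u j → sum (Ψ u (suc j)) ≡ u
sum-Ψ u zero    = trans (+-identityʳ (u / 1)) (n/1≡n u)
sum-Ψ u (suc j) = begin
  sum (Ψ u (2 + j))                    ≡⟨ cong sum (Ψ-step u j) ⟩
  ⌈ u /2⌉ + sum (Ψ (u div 2) (1 + j))  ≡⟨ cong (⌈ u /2⌉ +_) (trans (sum-Ψ (u div 2) j) (div-2≡⌊/2⌋ u)) ⟩
  ⌈ u /2⌉ + ⌊ u /2⌋                    ≡⟨ +-comm ⌈ u /2⌉ ⌊ u /2⌋ ⟩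
  ⌊ u /2⌋ + ⌈ u /2⌉                    ≡⟨ ⌊n/2⌋+⌈n/2⌉≡n u ⟩
  u                                    ∎
  where open ≡.≡-Reasoning

Ψ-≤ : ∀ j {u m} → u ≤ m + m → All (_≤ m) (Ψ u (2 + j))
Ψ-≤ j {u} {m} u≤2m = subst (All (_≤ m)) (sym (Ψ-step u j)) (⌈/2⌉≤ u≤2m ∷ tail j)
  where
  u/2≤m : u div 2 ≤ m
  u/2≤m = ≤-trans (≤-reflexive (div-2≡⌊/2⌋ u)) (≤-trans (⌊n/2⌋≤⌈n/2⌉ u) (⌈/2⌉≤ u≤2m))
  tail : ∀ j → All (_≤ m) (Ψ (u div 2) (1 + j))
  tail zero    = ≤-trans (≤-reflexive (n/1≡n (u div 2))) u/2≤m ∷ []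
  tail (suc j) = Ψ-≤ j (≤-trans u/2≤m (m≤m+n m m))

div-2^-suc-≤⌈/2⌉ : ∀ u j → u div (2 ^ suc j) ≤ ⌈ u /2⌉
div-2^-suc-≤⌈/2⌉ u j = begin
  u div (2 ^ suc j)      ≡⟨ div-2^-suc u j ⟩
  (u div 2) div (2 ^ j)  ≤⟨ div-2^-≤ (u div 2) j ⟩
  u div 2                ≡⟨ div-2≡⌊/2⌋ u ⟩
  ⌊ u /2⌋                ≤⟨ ⌊n/2⌋≤⌈n/2⌉ u ⟩
  ⌈ u /2⌉                ∎
  where open ≤-Reasoning

gapless-Ψ : ∀ j {h u R} → Gapless h (u div (2 ^ j) ∷ R) → Gapless h (Ψ u (suc j) ++ R)
gapless-Ψ zero    gapless = gapless
gapless-Ψ (suc j) {h} {u} {R} gapless = subst (λ xs → Gapless h (xs ++ R)) (sym (Ψ-step u j))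
  (cons h≤⌈u/2⌉ ⌈u/2⌉≤1+Σ (gapless-Ψ j (subst (λ x → Gapless h (x ∷ R)) (div-2^-suc u j) gapless)))
  where
  h≤⌈u/2⌉ : h ≤ ⌈ u /2⌉
  h≤⌈u/2⌉ = ≤-trans (All.head (gapless-≥ gapless)) (div-2^-suc-≤⌈/2⌉ u j)
  ⌈u/2⌉≤1+Σ : ⌈ u /2⌉ ≤ suc (sum (Ψ (u div 2) (suc j) ++ R))
  ⌈u/2⌉≤1+Σ = begin
    ⌈ u /2⌉                                       ≤⟨ ⌈/2⌉≤1+⌊/2⌋ u ⟩
    suc ⌊ u /2⌋                                   ≡⟨ cong suc (trans (sum-Ψ (u div 2) j) (div-2≡⌊/2⌋ u)) ⟨
    suc (sum (Ψ (u div 2) (suc j)))               ≤⟨ s≤s (m≤m+n _ (sum R)) ⟩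
    suc (sum (Ψ (u div 2) (suc j)) + sum R)       ≡⟨ cong suc (sum-++ (Ψ (u div 2) (suc j)) R) ⟨
    suc (sum (Ψ (u div 2) (suc j) ++ R))          ∎
    where open ≤-Reasoning

sum-replicate : ∀ p x → sum (replicate p x) ≡ p * x
sum-replicate zero    x = refl
sum-replicate (suc p) x = cong (x +_) (sum-replicate p x)

gapless-replicate : ∀ p {h x T} → Gapless h T → h ≤ x → x ≤ suc (sum T) → Gapless h (replicate p x ++ T)
gapless-replicate zero    gapless h≤x x≤1+ΣT = gapless
gapless-replicate (suc p) {h} {x} {T} gapless h≤x x≤1+ΣT =
  cons h≤x (≤-trans x≤1+ΣT (s≤s (≤-trans (m≤n+m (sum T) _) (≤-reflexive (sym (sum-++ (replicate p x) T))))))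
       (gapless-replicate p gapless h≤x x≤1+ΣT)

gapless-ones : ∀ z → Gapless 1 (replicate (suc z) 1)
gapless-ones zero    = end
gapless-ones (suc z) = cons ≤-refl (s≤s z≤n) (gapless-ones z)

admissible-cong : ∀ {k k′ n n′ m m′ h h′ T T′} → k ≡ k′ → n ≡ n′ → m ≡ m′ → h ≡ h′ → T ≡ T′ →
  Admissible k n m h T → Admissible k′ n′ m′ h′ T′
admissible-cong refl refl refl refl refl admissible = admissible

admissible-Ψ : ∀ p j {a m} → m < a → a ≤ m + m → 2 ^ suc j ≤ a →
  Admissible (p + (2 + j)) (p * m + a) m (a div (2 ^ suc j)) (replicate p m ++ Ψ a (2 + j))
admissible-Ψ p j {a} {m} m<a a≤2m 2ʲ⁺¹≤a = record
  { length≡ = trans (length-++ (replicate p m)) (cong₂ _+_ (length-replicate p) (length-Ψ a (suc j)))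
  ; sum≡    = trans (sum-++ (replicate p m) _) (cong₂ _+_ (sum-replicate p m) (sum-Ψ a (suc j)))
  ; ≤m      = ++⁺ (replicate⁺ p ≤-refl) (Ψ-≤ j a≤2m)
  ; gapless = gapless-replicate p (subst (Gapless _) (++-identityʳ (Ψ a (2 + j))) (gapless-Ψ (suc j) end))
                (≤-trans (div-2^-suc-≤⌈/2⌉ a j) (⌈/2⌉≤ a≤2m))
                (≤-trans (<⇒≤ m<a) (≤-trans (n≤1+n a) (≤-reflexive (cong suc (sym (sum-Ψ a (suc j)))))))
  ; 1≤h     = div-2^-≥1 {i = suc j} 2ʲ⁺¹≤a
  }

admissible-Ψ-ones : ∀ p w z {a m} → 1 ≤ m → m < a → a ≤ m + m →
  2 ^ suc w + suc z ≤ a → a < 2 ^ suc (suc w) + z →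
  Admissible (p + (2 + w + suc z)) (p * m + a) m 1 (replicate p m ++ Ψ (a ∸ suc z) (2 + w) ++ replicate (suc z) 1)
admissible-Ψ-ones p w z {a} {m} 1≤m m<a a≤2m lower upper = record
  { length≡ = trans (length-++ (replicate p m)) (cong₂ _+_ (length-replicate p)
                (trans (length-++ (Ψ u (2 + w))) (cong₂ _+_ (length-Ψ u (suc w)) (length-replicate (suc z)))))
  ; sum≡    = trans (sum-++ (replicate p m) _) (cong₂ _+_ (sum-replicate p m) sum-tail)
  ; ≤m      = ++⁺ (replicate⁺ p ≤-refl)
                  (++⁺ (Ψ-≤ w (≤-trans (m∸n≤m a (suc z)) a≤2m)) (replicate⁺ (suc z) 1≤m))
  ; gapless = gapless-replicate p (gapless-Ψ (suc w) (cons 1≤head head≤1+z (gapless-ones z))) 1≤m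
                (≤-trans (<⇒≤ m<a) (≤-trans (n≤1+n a) (≤-reflexive (cong suc (sym sum-tail)))))
  ; 1≤h     = ≤-refl
  }
  where
  u = a ∸ suc z
  u+z+1≡a : u + suc z ≡ a
  u+z+1≡a = m∸n+n≡m (≤-trans (m≤n+m (suc z) (2 ^ suc w)) lower)
  sum-tail : sum (Ψ u (2 + w) ++ replicate (suc z) 1) ≡ a
  sum-tail = trans (sum-++ (Ψ u (2 + w)) _)
    (trans (cong₂ _+_ (sum-Ψ u (suc w)) (trans (sum-replicate (suc z) 1) (*-identityʳ (suc z)))) u+z+1≡a)
  1≤head : 1 ≤ u div (2 ^ suc w)
  1≤head = div-2^-≥1 {i = suc w} (subst (_≤ u) (m+n∸n≡m (2 ^ suc w) (suc z)) (∸-monoˡ-≤ (suc z) lower))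
  head≤1+z : u div (2 ^ suc w) ≤ suc (sum (replicate (suc z) 1))
  head≤1+z = ≤-trans (div-2^-≤1 {i = suc w} u<2ʷ⁺²) (s≤s z≤n)
    where
    u<2ʷ⁺² : u < 2 ^ suc (suc w)
    u<2ʷ⁺² = +-cancelʳ-< (suc z) u (2 ^ suc (suc w))
      (subst (_< 2 ^ suc (suc w) + suc z) (sym u+z+1≡a)
        (<-≤-trans upper (+-monoʳ-≤ (2 ^ suc (suc w)) (n≤1+n z))))

admissible-ones : ∀ β γ o M → γ < M → suc M ≤ o →
  Admissible (β + suc o) (β * M + γ + (β + suc o)) (suc M) 1 (replicate β (suc M) ++ γ + 1 ∷ replicate o 1)
admissible-ones β γ zero    M γ<M ()
admissible-ones β γ (suc o) M γ<M M<1+o = record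
  { length≡ = trans (length-++ (replicate β (suc M)))
                (cong₂ _+_ (length-replicate β) (cong suc (length-replicate (suc o))))
  ; sum≡    = trans (sum-++ (replicate β (suc M)) _)
                (trans (cong₂ _+_ (sum-replicate β (suc M)) (cong (γ + 1 +_) Σones≡)) (regroup β γ o M))
  ; ≤m      = ++⁺ (replicate⁺ β ≤-refl) (γ+1≤1+M ∷ replicate⁺ (suc o) (s≤s z≤n))
  ; gapless = gapless-replicate β (cons (m≤n+m 1 γ) γ+1≤ (gapless-ones o)) (s≤s z≤n) 1+M≤
  ; 1≤h     = ≤-refl
  }
  where
  regroup : ∀ β γ o M → β * suc M + (γ + 1 + suc o) ≡ β * M + γ + (β + suc (suc o))
  regroup = solve-∀
  Σones≡ : sum (replicate (suc o) 1) ≡ suc o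
  Σones≡ = trans (sum-replicate (suc o) 1) (*-identityʳ (suc o))
  γ+1≤1+M : γ + 1 ≤ suc M
  γ+1≤1+M = subst (_≤ suc M) (+-comm 1 γ) (≤-trans γ<M (n≤1+n M))
  γ+1≤ : γ + 1 ≤ suc (sum (replicate (suc o) 1))
  γ+1≤ = begin
    γ + 1                          ≤⟨ γ+1≤1+M ⟩
    suc M                          ≤⟨ M<1+o ⟩
    suc o                          ≤⟨ n≤1+n (suc o) ⟩
    suc (suc o)                    ≡⟨ cong suc Σones≡ ⟨
    suc (sum (replicate (suc o) 1)) ∎
    where open ≤-Reasoning
  1+M≤ : suc M ≤ suc (sum (γ + 1 ∷ replicate (suc o) 1))
  1+M≤ = begin
    suc M                                  ≤⟨ M<1+o ⟩
    suc o                                  ≡⟨ Σones≡ ⟨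
    sum (replicate (suc o) 1)              ≤⟨ m≤n+m _ (γ + 1) ⟩
    γ + 1 + sum (replicate (suc o) 1)      ≤⟨ n≤1+n _ ⟩
    suc (γ + 1 + sum (replicate (suc o) 1)) ∎
    where open ≤-Reasoning

n<2^n : ∀ n → n < 2 ^ n
n<2^n zero    = s≤s z≤n
n<2^n (suc n) = subst₂ _≤_ (+-comm (suc n) 1) (cong (2 ^ n +_) (sym (+-identityʳ (2 ^ n))))
  (+-mono-≤ (n<2^n n) (m^n>0 2 n))

-- Writing D = k m ∸ n = t m + r with r < m and k = p + (t + 2) gives n = p m + a with a + r = 2m.
module Parameters {n m k : ℕ} (k<n : k < n) (m<n : m < n) (n≤km : n ≤ k * m) where
  t a p : ℕ
  t = tPar n m k
  a = aPar n m k
  p = k ∸ t ∸ 2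

  1<m : 1 < m
  1<m = ≰⇒> λ m≤1 → <⇒≱ k<n (≤-trans n≤km (≤-trans (*-monoʳ-≤ k m≤1) (≤-reflexive (*-identityʳ k))))

  private
    instance
      m≢0 : NonZero m
      m≢0 = ℕ.>-nonZero (<-trans (s≤s z≤n) 1<m)

    D r : ℕ
    D = k * m ∸ n
    r = D % m

    D+n≡km : D + n ≡ k * m
    D+n≡km = m∸n+n≡m n≤km

    D≡r+tm : D ≡ r + t * m
    D≡r+tm = trans (m≡m%n+[m/n]*n D m) (cong (λ x → r + x * m) (sym (div≡/ D m)))

    r<m : r < m
    r<m = m%n<n D m

  -- If k ≤ t + 1 then k m ≤ t m + m ≤ D + m, i.e. n ≤ m.
  t+2≤k : t + 2 ≤ k
  t+2≤k = ≮⇒≥ λ k<t+2 → <⇒≱ m<n (+-cancelˡ-≤ D n m (begin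
    D + n      ≡⟨ D+n≡km ⟩
    k * m      ≤⟨ *-monoˡ-≤ m (s≤s⁻¹ (subst (suc k ≤_) (+-suc t 1) k<t+2)) ⟩
    (t + 1) * m ≡⟨ trans (*-distribʳ-+ m t 1) (cong (t * m +_) (*-identityˡ m)) ⟩
    t * m + m  ≤⟨ +-monoˡ-≤ m (subst (t * m ≤_) (sym D≡r+tm) (m≤n+m (t * m) r)) ⟩
    D + m      ∎))
    where open ≤-Reasoning

  k≡p+[t+2] : k ≡ p + (t + 2)
  k≡p+[t+2] = sym (trans (cong (_+ (t + 2)) (∸-+-assoc k t 2)) (m∸n+n≡m t+2≤k))

  private
    r+n≡pm+2m : r + n ≡ p * m + (m + m)
    r+n≡pm+2m = +-cancelʳ-≡ (t * m) (r + n) (p * m + (m + m)) (begin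
      r + n + t * m           ≡⟨ swap r n (t * m) ⟩
      r + t * m + n           ≡⟨ cong (_+ n) D≡r+tm ⟨
      D + n                   ≡⟨ D+n≡km ⟩
      k * m                   ≡⟨ cong (_* m) k≡p+[t+2] ⟩
      (p + (t + 2)) * m       ≡⟨ expand p t m ⟩
      p * m + (m + m) + t * m ∎)
      where
      open ≡.≡-Reasoning
      swap : ∀ x y z → x + y + z ≡ x + z + y
      swap = solve-∀
      expand : ∀ p t m → (p + (t + 2)) * m ≡ p * m + (m + m) + t * m
      expand = solve-∀

    pm<n : p * m < n
    pm<n = +-cancelˡ-< m (p * m) n (begin-strict
      m + p * m           ≤⟨ m≤m+n (m + p * m) m ⟩
      m + p * m + m       ≡⟨ regroup m (p * m) ⟩
      p * m + (m + m)     ≡⟨ r+n≡pm+2m ⟨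
      r + n               <⟨ +-monoˡ-< n r<m ⟩
      m + n               ∎)
      where
      open ≤-Reasoning
      regroup : ∀ m x → m + x + m ≡ x + (m + m)
      regroup = solve-∀

  pm+a≡n : p * m + a ≡ n
  pm+a≡n = m+[n∸m]≡n (<⇒≤ pm<n)

  private
    a+r≡2m : a + r ≡ m + m
    a+r≡2m = +-cancelˡ-≡ (p * m) (a + r) (m + m) (begin
      p * m + (a + r)  ≡⟨ +-assoc (p * m) a r ⟨
      p * m + a + r    ≡⟨ cong (_+ r) pm+a≡n ⟩
      n + r            ≡⟨ +-comm n r ⟩
      r + n            ≡⟨ r+n≡pm+2m ⟩
      p * m + (m + m)  ∎)
      where open ≡.≡-Reasoning

  m<a : m < a
  m<a = ≰⇒> λ a≤m → <-irrefl a+r≡2m (+-mono-≤-< a≤m r<m)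

  a≤2m : a ≤ m + m
  a≤2m = subst (a ≤_) a+r≡2m (m≤m+n a r)

  hPar≡1 : a < 2 ^ (t + 1) → hPar n m k ≡ 1
  hPar≡1 a<2ᵗ⁺¹ = cong (ℕ._⊔ 1) (div-2^-≡0 {i = t + 1} a<2ᵗ⁺¹)

  hPar≡ : 2 ^ (t + 1) ≤ a → hPar n m k ≡ a div (2 ^ (t + 1))
  hPar≡ 2ᵗ⁺¹≤a = m≥n⇒m⊔n≡m (div-2^-≥1 {i = t + 1} 2ᵗ⁺¹≤a)

  tuple-A : InH a t 0 → Admissible k n m (hPar n m k) (replicate p m ++ Ψ a (t + 2))
  tuple-A (inj₂ (() , _))
  tuple-A (inj₁ (_ , 2ᵗ⁺¹+0≤a)) =
    admissible-cong (trans (cong (p +_) (+-comm 2 t)) (sym k≡p+[t+2])) pm+a≡n refl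
      (trans (cong (λ e → a div (2 ^ e)) (+-comm 1 t)) (sym (hPar≡ 2ᵗ⁺¹≤a)))
      (cong (λ v → replicate p m ++ Ψ a v) (+-comm 2 t))
      (admissible-Ψ p t m<a a≤2m (subst (λ e → 2 ^ e ≤ a) (+-comm t 1) 2ᵗ⁺¹≤a))
    where
    2ᵗ⁺¹≤a : 2 ^ (t + 1) ≤ a
    2ᵗ⁺¹≤a = subst (_≤ a) (+-identityʳ _) 2ᵗ⁺¹+0≤a

  tuple-B : ∀ z → t + 2 ≤ a → IsMinH a t (suc z) →
    Admissible k n m (hPar n m k) (replicate p m ++ Ψ (a ∸ suc z) (t ∸ suc z + 2) ++ replicate (suc z) 1)
  tuple-B z t+2≤a (1+z∈H , below-∉H) =
    admissible-cong k-eq pm+a≡n refl (sym h≡1)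
      (cong (λ v → replicate p m ++ Ψ (a ∸ suc z) v ++ replicate (suc z) 1) (+-comm 2 w))
      (admissible-Ψ-ones p w z (<⇒≤ 1<m) m<a a≤2m lower upper)
    where
    t∈H : InH a t t
    t∈H = inj₁ (m≤m+n t 1 ,
      subst (λ e → 2 ^ e + t ≤ a) (sym (m+n∸m≡n t 1)) (subst (_≤ a) (+-comm t 2) t+2≤a))
    1+z≤t : suc z ≤ t
    1+z≤t = ≮⇒≥ λ t<1+z → below-∉H t t<1+z t∈H
    w = t ∸ suc z
    w+1+z≡t : w + suc z ≡ t
    w+1+z≡t = m∸n+n≡m 1+z≤t
    k-eq : p + (2 + w + suc z) ≡ k
    k-eq = trans (cong (p +_) (trans (+-assoc 2 w (suc z)) (trans (cong (2 +_) w+1+z≡t) (+-comm 2 t))))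
             (sym k≡p+[t+2])
    lower : 2 ^ suc w + suc z ≤ a
    lower = from-H 1+z∈H
      where
      from-H : InH a t (suc z) → 2 ^ suc w + suc z ≤ a
      from-H (inj₁ (_ , 2ᵉ+1+z≤a)) =
        subst (λ e → 2 ^ e + suc z ≤ a) (trans (+-∸-comm 1 1+z≤t) (+-comm w 1)) 2ᵉ+1+z≤a
      from-H (inj₂ (t+1<1+z , _)) =
        contradiction (<⇒≤ (s≤s⁻¹ (subst (_< suc z) (+-comm t 1) t+1<1+z))) (<⇒≱ 1+z≤t)
    upper : a < 2 ^ suc (suc w) + z
    upper = ≰⇒> λ le → below-∉H z ≤-refl (inj₁ (≤-trans (n≤1+n z) (≤-trans 1+z≤t (m≤m+n t 1)) ,
              subst (λ e → 2 ^ e + z ≤ a) (sym t+1∸z≡2+w) le))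
      where
      t+1∸z≡2+w : t + 1 ∸ z ≡ suc (suc w)
      t+1∸z≡2+w = trans (cong (λ e → e + 1 ∸ z) (sym w+1+z≡t))
        (trans (cong (_∸ z) (regroup w z)) (m+n∸n≡m (suc (suc w)) z))
        where
        regroup : ∀ w z → w + suc z + 1 ≡ suc (suc w) + z
        regroup = solve-∀
    h≡1 : hPar n m k ≡ 1
    h≡1 = hPar≡1 (≰⇒> λ 2ᵗ⁺¹≤a →
      below-∉H 0 (s≤s z≤n) (inj₁ (z≤n , subst (_≤ a) (sym (+-identityʳ _)) 2ᵗ⁺¹≤a)))

  β γ : ℕ
  β = (n ∸ k) div (m ∸ 1)
  γ = (n ∸ k) ∸ (m ∸ 1) * β

  tuple-C : ¬ t + 2 ≤ a →
    Admissible k n m (hPar n m k) (replicate β m ++ (γ + 1 ∷ []) ++ replicate (k ∸ β ∸ 1) 1)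
  tuple-C t+2≰a =
    admissible-cong k-eq n-eq 1+M≡m (sym h≡1) (cong (λ x → replicate β x ++ γ + 1 ∷ replicate o 1) 1+M≡m)
      (admissible-ones β γ o M γ<M 1+M≤o)
    where
    M N o : ℕ
    M = m ∸ 1
    N = n ∸ k
    o = k ∸ β ∸ 1
    1+M≡m : suc M ≡ m
    1+M≡m = trans (+-comm 1 M) (m∸n+n≡m (<⇒≤ 1<m))
    instance
      M≢0 : NonZero M
      M≢0 = ℕ.>-nonZero (∸-monoˡ-≤ 1 1<m)
    N+k≡n : N + k ≡ n
    N+k≡n = m∸n+n≡m (<⇒≤ k<n)
    a≤t+1 : a ≤ t + 1
    a≤t+1 = s≤s⁻¹ (subst (a <_) (+-suc t 1) (≰⇒> t+2≰a))
    m≤t : m ≤ t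
    m≤t = s≤s⁻¹ (subst (m <_) (+-comm t 1) (<-≤-trans m<a a≤t+1))
    h≡1 : hPar n m k ≡ 1
    h≡1 = hPar≡1 (≤-<-trans a≤t+1 (n<2^n (t + 1)))
    γ≡N%M : γ ≡ N % M
    γ≡N%M = trans (cong (N ∸_) (trans (*-comm M β) (cong (_* M) (div≡/ N M)))) (sym (m%n≡m∸m/n*n N M))
    γ<M : γ < M
    γ<M = subst (_< M) (sym γ≡N%M) (m%n<n N M)
    N≡βM+γ : N ≡ β * M + γ
    N≡βM+γ = trans (m≡m%n+[m/n]*n N M)
      (trans (cong₂ _+_ (sym γ≡N%M) (cong (_* M) (sym (div≡/ N M)))) (+-comm γ (β * M)))
    -- n ≤ (p + 2) m = (p + 2) M + (p + 2) while k ≥ p + 2 + m, so n ∸ k < (p + 2) M.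
    N<[p+2]M : N < (p + 2) * M
    N<[p+2]M = ≤-trans (s≤s (m≤m+n N M)) (+-cancelʳ-≤ (p + 2) (suc N + M) ((p + 2) * M) (begin
      suc N + M + (p + 2)          ≡⟨ regroupˡ N M p ⟩
      N + (p + (suc M + 2))        ≤⟨ +-monoʳ-≤ N (+-monoʳ-≤ p (+-monoˡ-≤ 2 (subst (_≤ t) (sym 1+M≡m) m≤t))) ⟩
      N + (p + (t + 2))            ≡⟨ cong (N +_) k≡p+[t+2] ⟨
      N + k                        ≡⟨ N+k≡n ⟩
      n                            ≡⟨ pm+a≡n ⟨
      p * m + a                    ≤⟨ +-monoʳ-≤ (p * m) a≤2m ⟩
      p * m + (m + m)              ≡⟨ cong (λ x → p * x + (x + x)) 1+M≡m ⟨
      p * suc M + (suc M + suc M)  ≡⟨ regroupʳ p M ⟩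
      (p + 2) * M + (p + 2)        ∎))
      where
      open ≤-Reasoning
      regroupˡ : ∀ N M p → suc N + M + (p + 2) ≡ N + (p + (suc M + 2))
      regroupˡ = solve-∀
      regroupʳ : ∀ p M → p * suc M + (suc M + suc M) ≡ (p + 2) * M + (p + 2)
      regroupʳ = solve-∀
    β+1+m≤k : β + 1 + m ≤ k
    β+1+m≤k = begin
      β + 1 + m    ≤⟨ +-monoˡ-≤ m (subst (_≤ p + 2) (+-comm 1 β) β<p+2) ⟩
      p + 2 + m    ≤⟨ +-monoʳ-≤ (p + 2) m≤t ⟩
      p + 2 + t    ≡⟨ regroup p t ⟩
      p + (t + 2)  ≡⟨ k≡p+[t+2] ⟨
      k            ∎
      where
      open ≤-Reasoning
      β<p+2 : β < p + 2
      β<p+2 = subst (_< p + 2) (sym (div≡/ N M)) (m<n*o⇒m/o<n N<[p+2]M)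
      regroup : ∀ p t → p + 2 + t ≡ p + (t + 2)
      regroup = solve-∀
    β+1+o≡k : β + 1 + o ≡ k
    β+1+o≡k = trans (cong (β + 1 +_) (∸-+-assoc k β 1)) (m+[n∸m]≡n (≤-trans (m≤m+n (β + 1) m) β+1+m≤k))
    k-eq : β + suc o ≡ k
    k-eq = trans (sym (+-assoc β 1 o)) β+1+o≡k
    n-eq : β * M + γ + (β + suc o) ≡ n
    n-eq = trans (cong₂ _+_ (sym N≡βM+γ) k-eq) N+k≡n
    1+M≤o : suc M ≤ o
    1+M≤o = subst (_≤ o) (sym 1+M≡m)
      (+-cancelˡ-≤ (β + 1) m o (subst (β + 1 + m ≤_) (sym β+1+o≡k) β+1+m≤k))

tuple-admissible : ∀ {n m k z} → k < n → m < n → n ≤ k * m →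
  (tPar n m k + 2 ≤ aPar n m k → IsMinH (aPar n m k) (tPar n m k) z) →
  Admissible k n m (hPar n m k) (tuple n m k z)
tuple-admissible {n} {m} {k} {z} k<n m<n n≤km z-min = by-cases z (≤ᵇ-reflects-≤ (t + 2) a) z-min
  where
  open Parameters k<n m<n n≤km
  -- The definition of tuple n m k z, with its test (t + 2 ≤ᵇ a) abstracted as b.
  by-cases : ∀ z {b} → Reflects (t + 2 ≤ a) b → (t + 2 ≤ a → IsMinH a t z) →
    Admissible k n m (hPar n m k)
      (if b then (if z ℕ.≡ᵇ 0 then replicate p m ++ Ψ a (t + 2)
                  else replicate p m ++ Ψ (a ∸ z) (t ∸ z + 2) ++ replicate z 1)
       else replicate β m ++ (γ + 1 ∷ []) ++ replicate (k ∸ β ∸ 1) 1)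
  by-cases zero    (ofʸ t+2≤a) z-min = tuple-A (proj₁ (z-min t+2≤a))
  by-cases (suc z) (ofʸ t+2≤a) z-min = tuple-B z t+2≤a (z-min t+2≤a)
  by-cases _       (ofⁿ t+2≰a) _     = tuple-C t+2≰a

theorem4p8 : ∀ {c ℓ : Level} (L : CommutativeRing c ℓ) → IsFieldCR L
    → (K : CommutativeRing.Carrier L → Set ℓ) → IsSubfield L K
    → (q m n k : ℕ) → IsPrimePower q
    → HasCard L K q → HasCard L (λ _ → ⊤) (q ^ m)
    → 1 < k → k < n → m < n → n ≤ k * m
    → (λ₀ : CommutativeRing.Carrier L) → Generates L K λ₀
    → (z : ℕ) → (tPar n m k + 2 ≤ aPar n m k → IsMinH (aPar n m k) (tPar n m k) z)
    → IsCodeParams L λ₀ (tuple n m k z) n k m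
      × (∀ r → InWS L K λ₀ (tuple n m k z) r → hPar n m k ≤ r × r ≤ m)
      × (∀ r → hPar n m k ≤ r → r ≤ m → InWS L K λ₀ (tuple n m k z) r)
theorem4p8 L isField K K-subfield q m n k _ K-card L-card _ k<n m<n n≤km λ₀ generates z z-min =
  weight-spectrum (tuple-admissible k<n m<n n≤km z-min) (<⇒≤ m<n)
  where
  open GeneratorPowers L isField K K-subfield K-card {m} L-card λ₀ generates using (powers-independent)
  open CodeWeights L isField K K-subfield K-card {m} L-card λ₀ powers-independent using (weight-spectrum)
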